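{- Let $k \ge 2$ and $d \in \mathbb{N}$. For every $n \in \mathbb{N}$, \[ c^{(k)}(d;n) = \sum_{i=\max\{n-k+1,0\}}^{n-1} c^{(k)}(d;i) + [d\ge k]\, c^{(k)}(d-k;n-k) + [d<k]\,[n=d], \] where $c^{(k)}(\cdot\,;m)=0$ for $m<0$ and an empty sum is $0$.
   Context: Words are over the alphabet $\mathbb{N}=\{0,1,2,\dots\}$ (letters called digits). For $k\ge 2$, $\phi_k:\mathbb{N}^*\to\mathbb{N}^*$ is the morphism defined for $i\in\mathbb{N}$, $0\le j\le k-1$ by $\phi_k(ki+j)=(ki)(ki+j+1)$ if $0\le j\le k-2$ and $\phi_k(ki+k-1)=ki+k$. Set $W_n^{(k)}=\phi_k^n(0)$. For a digit $d$, $c^{(k)}(d;n)$ denotes the number of occurrences of $d$ in $W_n^{(k)}$. $[P]$ is the Iverson bracket (1 if $P$ holds, 0 otherwise). -}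

module Defs where

open import Data.Nat using (ℕ; zero; suc; _+_; _*_; _∸_; _<_; _≤_; _≤ᵇ_; _≡ᵇ_)
open import Data.Nat.DivMod using (_/_; _%_)
open import Data.List using (List; []; _∷_; _++_; concatMap; length; filter)
open import Data.Bool using (Bool; true; false; if_then_else_)
open import Relation.Nullary.Decidable using (⌊_⌋)
import Data.Nat as N

-- Image of a single digit x = k*i + j (0 ≤ j ≤ k-1) under φ_k.
-- φ_k(ki+j) = (ki)(ki+j+1) if j ≤ k-2, and φ_k(ki+k-1) = ki+k.
-- (k = 0 is meaningless; it is excluded by the hypothesis 2 ≤ k.)
phiDigit : ℕ → ℕ → List ℕ
phiDigit zero x = x ∷ []
phiDigit (suc m) x =
  let k = suc m
      i = x / k
      j = x % k
  in if (suc j N.≡ᵇ k)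
       then (k * i + k) ∷ []
       else (k * i) ∷ (k * i + suc j) ∷ []

phi : ℕ → List ℕ → List ℕ
phi k w = concatMap (phiDigit k) w

W : ℕ → ℕ → List ℕ
W k zero = 0 ∷ []
W k (suc n) = phi k (W k n)

count : ℕ → List ℕ → ℕ
count d [] = 0
count d (x ∷ w) = (if x N.≡ᵇ d then 1 else 0) + count d w

c : ℕ → ℕ → ℕ → ℕ
c k d n = count d (W k n)

iv : Bool → ℕ
iv true = 1
iv false = 0

-- sum_{i=max(n-k+1,0)}^{n-1} f i, i.e. sum over i < n with n < i + k
windowSum : ℕ → ℕ → (ℕ → ℕ) → ℕ
windowSum k zero f = 0
windowSum k (suc n') f = go n'
  where
  go : ℕ → ℕ
  go zero = iv (suc (suc n') N.≤ᵇ 0 + k) * f 0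
  go (suc m) = iv (suc (suc n') N.≤ᵇ suc m + k) * f (suc m) + go m

-- c^{(k)}(d-k; n-k) with the convention c(·; m) = 0 for m < 0
cShift : ℕ → ℕ → ℕ → ℕ
cShift k d n = iv (k N.≤ᵇ n) * c k (d ∸ k) (n ∸ k)

{-# OPTIONS --safe #-}
module Submission where

-- For j + 1 < k we have φ(j) = 0 (j+1), hence φ^(m+1)(j) = φ^m(0) φ^m(j+1) = W_m φ^m(j+1).
-- Unrolling this from W_n = φ^n(0) for min(n, k-1) steps gives W_n = W_(n-1) ⋯ W_(n-t) φ^(n-t)(t),
-- which accounts for the window sum.  If n < k the tail is the single digit n.  Otherwise the tail
-- is φ^(n-k+1)(k-1) = φ^(n-k)(k), and since φ commutes with adding k to every digit this is
-- W_(n-k) shifted by k, which contains d exactly as often as W_(n-k) contains d - k when d ≥ k,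
-- and never when d < k.

open import Defs
open import Relation.Binary.PropositionalEquality using (_≡_)
open import Data.Nat using (ℕ; _+_; _*_; _≤_; _<ᵇ_; _≤ᵇ_; _≡ᵇ_)

open import Data.Bool using (true; false; T; if_then_else_)
open import Data.List using (List; []; _∷_; _++_; map; concatMap)
open import Data.List.Properties using (concatMap-++; concatMap-map; concatMap-cong; map-concatMap)
open import Data.Nat using (NonZero; zero; suc; _∸_; _<_; s≤s; _<?_; _≟_)
open import Data.Nat.Divisibility using (∣-refl)
open import Data.Nat.DivMod using (_/_; _%_; +-distrib-/-∣ˡ; n/n≡1; [m+n]%n≡m%n; m<n⇒m/n≡0; m<n⇒m%n≡m)
open import Data.Nat.GeneralisedArithmetic using (fold; fold-+)
open import Data.Nat.Properties
open import Data.Product using (_,_)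
open import Data.Unit using (tt)
open import Function using (_∘_)
open import Relation.Nullary using (¬_; yes; no; contradiction)
open import Relation.Binary.PropositionalEquality using (_≢_; refl; sym; trans; cong; cong₂; subst; module ≡-Reasoning)

open ≡-Reasoning

sum< : ℕ → (ℕ → ℕ) → ℕ
sum< zero    f = 0
sum< (suc n) f = sum< n f + f n

syntax sum< n (λ i → x) = ∑[ i < n ] x

iv-true : ∀ {b} → T b → iv b ≡ 1
iv-true {true} _ = refl

iv-false : ∀ {b} → ¬ T b → iv b ≡ 0
iv-false {false} _ = refl
iv-false {true}  ¬t = contradiction tt ¬t

+-≡ᵇ-+ : ∀ k x y → (k + x ≡ᵇ k + y) ≡ (x ≡ᵇ y)
+-≡ᵇ-+ zero    x y = refl
+-≡ᵇ-+ (suc k) x y = +-≡ᵇ-+ k x y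

≡ᵇ-refl : ∀ n → (n ≡ᵇ n) ≡ true
≡ᵇ-refl zero    = refl
≡ᵇ-refl (suc n) = ≡ᵇ-refl n

≢⇒≡ᵇ≡false : ∀ {m n} → m ≢ n → (m ≡ᵇ n) ≡ false
≢⇒≡ᵇ≡false {zero}  {zero}  m≢n = contradiction refl m≢n
≢⇒≡ᵇ≡false {zero}  {suc n} _   = refl
≢⇒≡ᵇ≡false {suc m} {zero}  _   = refl
≢⇒≡ᵇ≡false {suc m} {suc n} m≢n = ≢⇒≡ᵇ≡false (m≢n ∘ cong suc)

count-++ : ∀ d u v → count d (u ++ v) ≡ count d u + count d v
count-++ d []      v = refl
count-++ d (x ∷ u) v = trans (cong (_ +_) (count-++ d u v)) (sym (+-assoc (if x ≡ᵇ d then 1 else 0) (count d u) _))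

count-[_] : ∀ x d → count d (x ∷ []) ≡ iv (x ≡ᵇ d)
count-[ x ] d with x ≡ᵇ d
... | true  = refl
... | false = refl

count-map-+-+ : ∀ k e w → count (k + e) (map (k +_) w) ≡ count e w
count-map-+-+ k e []      = refl
count-map-+-+ k e (x ∷ w) rewrite +-≡ᵇ-+ k x e = cong (_ +_) (count-map-+-+ k e w)

count-map-+-< : ∀ {k d} w → d < k → count d (map (k +_) w) ≡ 0
count-map-+-< []      d<k = refl
count-map-+-< {k} (x ∷ w) d<k rewrite ≢⇒≡ᵇ≡false (>⇒≢ (≤-trans d<k (m≤m+n k x))) = count-map-+-< w d<k

count-map-+ : ∀ k d w → count d (map (k +_) w) ≡ iv (k ≤ᵇ d) * count (d ∸ k) w
count-map-+ k d w with d <? k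
... | yes d<k rewrite iv-false (<⇒≱ d<k ∘ ≤ᵇ⇒≤ k d) = count-map-+-< w d<k
... | no  d≮k with e , refl ← m≤n⇒∃[o]m+o≡n (≮⇒≥ d≮k)
  rewrite iv-true (≤⇒≤ᵇ (m≤m+n k e)) | m+n∸m≡n k e = trans (count-map-+-+ k e w) (sym (+-identityʳ _))

[n+m]/n≡1+m/n : ∀ n .{{_ : NonZero n}} m → (n + m) / n ≡ suc (m / n)
[n+m]/n≡1+m/n n m = trans (+-distrib-/-∣ˡ m ∣-refl) (cong (_+ m / n) (n/n≡1 n))

[n+m]%n≡m%n : ∀ n .{{_ : NonZero n}} m → (n + m) % n ≡ m % n
[n+m]%n≡m%n n m = trans (cong (_% n) (+-comm n m)) ([m+n]%n≡m%n m n)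

phiDigit-< : ∀ {k j} → suc j < k → phiDigit k j ≡ 0 ∷ suc j ∷ []
phiDigit-< {k@(suc _)} {j} 1+j<k
  rewrite m<n⇒m/n≡0 (<-trans (n<1+n j) 1+j<k) | m<n⇒m%n≡m (<-trans (n<1+n j) 1+j<k)
        | *-zeroʳ k | ≢⇒≡ᵇ≡false (<⇒≢ 1+j<k) = refl

phiDigit-pred : ∀ k → phiDigit (suc k) k ≡ suc k ∷ []
phiDigit-pred k rewrite m<n⇒m/n≡0 (n<1+n k) | m<n⇒m%n≡m (n<1+n k) | *-zeroʳ k | ≡ᵇ-refl k = refl

phiDigit-+ : ∀ k .{{_ : NonZero k}} x → phiDigit k (k + x) ≡ map (k +_) (phiDigit k x)
phiDigit-+ k@(suc _) x rewrite [n+m]/n≡1+m/n k x | [n+m]%n≡m%n k x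
  with suc (x % k) ≡ᵇ k
... | true  = cong (_∷ []) (trans (cong (_+ k) (*-suc k (x / k))) (+-assoc k (k * (x / k)) k))
... | false = cong₂ (λ a b → a ∷ b ∷ []) (*-suc k (x / k))
                (trans (cong (_+ suc (x % k)) (*-suc k (x / k))) (+-assoc k (k * (x / k)) _))

phi-++ : ∀ k u v → phi k (u ++ v) ≡ phi k u ++ phi k v
phi-++ k = concatMap-++ (phiDigit k)

phi-map-+ : ∀ k .{{_ : NonZero k}} w → phi k (map (k +_) w) ≡ map (k +_) (phi k w)
phi-map-+ k w = begin
  phi k (map (k +_) w)                        ≡⟨ concatMap-map (phiDigit k) (k +_) w ⟩
  concatMap (λ x → phiDigit k (k + x)) w      ≡⟨ concatMap-cong (phiDigit-+ k) w ⟩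
  concatMap (λ x → map (k +_) (phiDigit k x)) w ≡⟨ map-concatMap (k +_) (phiDigit k) w ⟨
  map (k +_) (phi k w)                        ∎

phi^ : ℕ → ℕ → List ℕ → List ℕ
phi^ k m w = fold w (phi k) m

W≡phi^ : ∀ k n → W k n ≡ phi^ k n (0 ∷ [])
W≡phi^ k zero    = refl
W≡phi^ k (suc n) = cong (phi k) (W≡phi^ k n)

phi^-suc : ∀ k m w → phi^ k (suc m) w ≡ phi^ k m (phi k w)
phi^-suc k m w = trans (cong (λ n → phi^ k n w) (+-comm 1 m)) (fold-+ w (phi k) m)

phi^-++ : ∀ k m u v → phi^ k m (u ++ v) ≡ phi^ k m u ++ phi^ k m v
phi^-++ k zero    u v = refl
phi^-++ k (suc m) u v = trans (cong (phi k) (phi^-++ k m u v)) (phi-++ k (phi^ k m u) _)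

phi^-map-+ : ∀ k .{{_ : NonZero k}} m w → phi^ k m (map (k +_) w) ≡ map (k +_) (phi^ k m w)
phi^-map-+ k zero    w = refl
phi^-map-+ k (suc m) w = trans (cong (phi k) (phi^-map-+ k m w)) (phi-map-+ k (phi^ k m w))

-- The local function `go` of windowSum cannot be referred to by name.  After the `with`
-- below, the normal form of the goal applies `go` to distinct variables, so unification
-- solves the metavariable windowGo to `go` itself and its defining equations hold by refl.
mutual
  windowGo : ℕ → ℕ → (ℕ → ℕ) → ℕ → ℕ
  windowGo = _

  private
    windowGo-solution : ∀ k n f → windowSum k (suc (suc n)) f ≡ windowSum k (suc (suc n)) f
    windowGo-solution k n f with suc n
    ... | m = refl {x = iv (m <ᵇ n + k) * f m + windowGo k m f n}

windowGo-all : ∀ {k n} f m → suc n < k → windowGo k n f m ≡ ∑[ i < suc m ] f i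
windowGo-all f zero    n<k rewrite iv-true (≤⇒≤ᵇ n<k) = +-identityʳ (f 0)
windowGo-all {k} f (suc m) n<k
  rewrite iv-true (≤⇒≤ᵇ (≤-trans n<k (m≤n+m k (suc m)))) | windowGo-all f m n<k
  = trans (cong (_+ ∑[ i < suc m ] f i) (+-identityʳ (f (suc m)))) (+-comm (f (suc m)) _)

windowGo-none : ∀ {k n} f m → m + k ≤ suc n → windowGo k n f m ≡ 0
windowGo-none f zero    k≤n rewrite iv-false (<⇒≱ (s≤s k≤n) ∘ ≤ᵇ⇒≤ _ _) = refl
windowGo-none f (suc m) m+k≤n rewrite iv-false (<⇒≱ (s≤s m+k≤n) ∘ ≤ᵇ⇒≤ _ _) =
  windowGo-none f m (≤-trans (n≤1+n _) m+k≤n)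

windowGo-+ : ∀ {k n} f s t → suc n ≤ s + k →
             windowGo k n f (t + s) ≡ windowGo k n f s + ∑[ i < t ] f (suc s + i)
windowGo-+ f s zero    _ = sym (+-identityʳ _)
windowGo-+ {k} {n} f s (suc t) n<s+k
  rewrite iv-true (≤⇒≤ᵇ (s≤s (≤-trans n<s+k (+-monoˡ-≤ k (m≤n+m s t))))) | windowGo-+ f s t n<s+k
  = begin
    f (suc (t + s)) + 0 + (windowGo k n f s + ∑[ i < t ] f (suc s + i))
      ≡⟨ cong (_+ (windowGo k n f s + ∑[ i < t ] f (suc s + i))) (trans (+-identityʳ _) (cong (f ∘ suc) (+-comm t s))) ⟩
    f (suc s + t) + (windowGo k n f s + ∑[ i < t ] f (suc s + i))
      ≡⟨ +-comm (f (suc s + t)) _ ⟩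
    windowGo k n f s + ∑[ i < t ] f (suc s + i) + f (suc s + t)
      ≡⟨ +-assoc (windowGo k n f s) _ _ ⟩
    windowGo k n f s + ∑[ i < suc t ] f (suc s + i)
      ∎

windowSum-short : ∀ {k n} f → n < k → windowSum k n f ≡ ∑[ i < n ] f i
windowSum-short {n = zero}  f _   = refl
windowSum-short {n = suc n} f n<k = windowGo-all f n n<k

windowSum-long : ∀ k s f → windowSum (suc k) (suc k + s) f ≡ ∑[ i < k ] f (suc s + i)
windowSum-long k s f = begin
  windowSum (suc k) (suc k + s) f                          ≡⟨ windowGo-+ f s k (≤-reflexive 1+k+s≡s+1+k) ⟩
  windowGo (suc k) (k + s) f s + ∑[ i < k ] f (suc s + i)   ≡⟨ cong (_+ ∑[ i < k ] f (suc s + i))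
                                                                    (windowGo-none f s (≤-reflexive (sym 1+k+s≡s+1+k))) ⟩
  ∑[ i < k ] f (suc s + i)                                  ∎
  where
  1+k+s≡s+1+k : suc k + s ≡ s + suc k
  1+k+s≡s+1+k = +-comm (suc k) s

cShift-< : ∀ {k n} d → n < k → cShift k d n ≡ 0
cShift-< {k} {n} d n<k rewrite iv-false (<⇒≱ n<k ∘ ≤ᵇ⇒≤ k n) = refl

cShift-+ : ∀ k d s → cShift k d (k + s) ≡ c k (d ∸ k) s
cShift-+ k d s rewrite iv-true (≤⇒≤ᵇ (m≤m+n k s)) | m+n∸m≡n k s = +-identityʳ _

iv-<ᵇ*iv-≡ᵇ-< : ∀ {k n} d → n < k → iv (d <ᵇ k) * iv (n ≡ᵇ d) ≡ iv (n ≡ᵇ d)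
iv-<ᵇ*iv-≡ᵇ-< {k} {n} d n<k with n ≟ d
... | yes refl rewrite iv-true (<⇒<ᵇ n<k) = *-identityˡ _
... | no  n≢d  rewrite iv-false (n≢d ∘ ≡ᵇ⇒≡ n d) = *-zeroʳ (iv (d <ᵇ k))

iv-<ᵇ*iv-≡ᵇ-≥ : ∀ {k n} d → k ≤ n → iv (d <ᵇ k) * iv (n ≡ᵇ d) ≡ 0
iv-<ᵇ*iv-≡ᵇ-≥ {k} {n} d k≤n with d <? k
... | yes d<k rewrite iv-false (λ n≡ᵇd → <⇒≱ d<k (≤-trans k≤n (≤-reflexive (≡ᵇ⇒≡ n d n≡ᵇd)))) = *-zeroʳ (iv (d <ᵇ k))
... | no  d≮k rewrite iv-false (d≮k ∘ <ᵇ⇒< d k) = refl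

module Occurrences (k′ d : ℕ) where

  k : ℕ
  k = suc k′

  occ : ℕ → ℕ → ℕ
  occ m j = count d (phi^ k m (j ∷ []))

  c≡occ : ∀ m → c k d m ≡ occ m 0
  c≡occ m = cong (count d) (W≡phi^ k m)

  occ-suc-< : ∀ m {j} → suc j < k → occ (suc m) j ≡ c k d m + occ m (suc j)
  occ-suc-< m {j} 1+j<k = begin
    count d (phi^ k (suc m) (j ∷ []))                    ≡⟨ cong (count d) (phi^-suc k m (j ∷ [])) ⟩
    count d (phi^ k m (phiDigit k j ++ []))              ≡⟨ cong (λ w → count d (phi^ k m (w ++ []))) (phiDigit-< 1+j<k) ⟩
    count d (phi^ k m ((0 ∷ []) ++ (suc j ∷ [])))        ≡⟨ cong (count d) (phi^-++ k m (0 ∷ []) (suc j ∷ [])) ⟩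
    count d (phi^ k m (0 ∷ []) ++ phi^ k m (suc j ∷ [])) ≡⟨ count-++ d (phi^ k m (0 ∷ [])) _ ⟩
    occ m 0 + occ m (suc j)                              ≡⟨ cong (_+ occ m (suc j)) (c≡occ m) ⟨
    c k d m + occ m (suc j)                              ∎

  occ-suc-pred : ∀ m → occ (suc m) k′ ≡ count d (map (k +_) (W k m))
  occ-suc-pred m = begin
    count d (phi^ k (suc m) (k′ ∷ []))         ≡⟨ cong (count d) (phi^-suc k m (k′ ∷ [])) ⟩
    count d (phi^ k m (phiDigit k k′ ++ []))   ≡⟨ cong (λ w → count d (phi^ k m (w ++ []))) (phiDigit-pred k′) ⟩
    count d (phi^ k m (k ∷ []))                ≡⟨ cong (λ x → count d (phi^ k m (x ∷ []))) (+-identityʳ k) ⟨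
    count d (phi^ k m (map (k +_) (0 ∷ [])))   ≡⟨ cong (count d) (phi^-map-+ k m (0 ∷ [])) ⟩
    count d (map (k +_) (phi^ k m (0 ∷ [])))   ≡⟨ cong (count d ∘ map (k +_)) (W≡phi^ k m) ⟨
    count d (map (k +_) (W k m))               ∎

  occ-telescope : ∀ t j a → j + t < k → occ (t + a) j ≡ ∑[ i < t ] c k d (a + i) + occ a (j + t)
  occ-telescope zero    j a _     = cong (occ a) (sym (+-identityʳ j))
  occ-telescope (suc t) j a j+t<k = begin
    occ (suc (t + a)) j                                       ≡⟨ occ-suc-< (t + a) (≤-<-trans (s≤s (m≤m+n j t)) 1+j+t<k) ⟩
    c k d (t + a) + occ (t + a) (suc j)                       ≡⟨ cong (c k d (t + a) +_) (occ-telescope t (suc j) a 1+j+t<k) ⟩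
    c k d (t + a) + (∑[ i < t ] c k d (a + i) + occ a (suc j + t)) ≡⟨ +-assoc (c k d (t + a)) _ _ ⟨
    c k d (t + a) + ∑[ i < t ] c k d (a + i) + occ a (suc j + t)
      ≡⟨ cong₂ _+_ (trans (+-comm (c k d (t + a)) _) (cong (λ m → ∑[ i < t ] c k d (a + i) + c k d m) (+-comm t a)))
                   (cong (occ a) (sym (+-suc j t))) ⟩
    ∑[ i < suc t ] c k d (a + i) + occ a (j + suc t)          ∎
    where
    1+j+t<k : suc j + t < k
    1+j+t<k = subst (_< k) (+-suc j t) j+t<k

  c-short : ∀ {n} → n < k → c k d n ≡ ∑[ i < n ] c k d i + iv (n ≡ᵇ d)
  c-short {n} n<k = begin
    c k d n                         ≡⟨ c≡occ n ⟩
    occ n 0                         ≡⟨ cong (λ m → occ m 0) (+-identityʳ n) ⟨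
    occ (n + 0) 0                   ≡⟨ occ-telescope n 0 0 n<k ⟩
    ∑[ i < n ] c k d i + occ 0 n    ≡⟨ cong (∑[ i < n ] c k d i +_) (count-[ n ] d) ⟩
    ∑[ i < n ] c k d i + iv (n ≡ᵇ d) ∎

  c-long : ∀ s → c k d (k + s) ≡ ∑[ i < k′ ] c k d (suc s + i) + count d (map (k +_) (W k s))
  c-long s = begin
    c k d (k + s)                                ≡⟨ c≡occ (k + s) ⟩
    occ (suc (k′ + s)) 0                         ≡⟨ cong (λ m → occ m 0) (+-suc k′ s) ⟨
    occ (k′ + suc s) 0                           ≡⟨ occ-telescope k′ 0 (suc s) ≤-refl ⟩
    ∑[ i < k′ ] c k d (suc s + i) + occ (suc s) k′ ≡⟨ cong (∑[ i < k′ ] c k d (suc s + i) +_) (occ-suc-pred s) ⟩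
    ∑[ i < k′ ] c k d (suc s + i) + count d (map (k +_) (W k s)) ∎

  recurrence-short : ∀ {n} → n < k →
    c k d n ≡ windowSum k n (c k d) + iv (k ≤ᵇ d) * cShift k d n + iv (d <ᵇ k) * iv (n ≡ᵇ d)
  recurrence-short {n} n<k
    rewrite cShift-< d n<k | *-zeroʳ (iv (k ≤ᵇ d)) | +-identityʳ (windowSum k n (c k d))
          | iv-<ᵇ*iv-≡ᵇ-< d n<k | windowSum-short (c k d) n<k
    = c-short n<k

  recurrence-long : ∀ s → c k d (k + s) ≡ windowSum k (k + s) (c k d)
                          + iv (k ≤ᵇ d) * cShift k d (k + s) + iv (d <ᵇ k) * iv (k + s ≡ᵇ d)
  recurrence-long s
    rewrite iv-<ᵇ*iv-≡ᵇ-≥ d (m≤m+n k s) | cShift-+ k d s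
          | +-identityʳ (windowSum k (k + s) (c k d) + iv (k ≤ᵇ d) * c k (d ∸ k) s)
          | windowSum-long k′ s (c k d) | sym (count-map-+ k d (W k s))
    = c-long s

-- The recurrence holds for every k ≥ 1; the hypothesis 2 ≤ k is only used to exclude k = 0.
lemma4p1 : (k d : ℕ) → 2 ≤ k → (n : ℕ) →
    c k d n ≡ windowSum k n (c k d)
              + iv (k ≤ᵇ d) * cShift k d n
              + iv (d <ᵇ k) * iv (n ≡ᵇ d)
lemma4p1 (suc k′) d _ n with n <? suc k′
... | yes n<k = Occurrences.recurrence-short k′ d n<k
... | no  n≮k with s , refl ← m≤n⇒∃[o]m+o≡n (≮⇒≥ n≮k) = Occurrences.recurrence-long k′ d s
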